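{- Let $r\ge1$ and $n\ge 2r+1$ be integers, let $P_n$ be the path with vertices $x_1,\dots,x_n$ labeled consecutively, and let $D\subseteq V(P_n)$. Then $D$ is an $r$-identifying code of $P_n$ if and only if all of the following hold: (1) there is no $i$ with $1\le i$ and $i+2r+1\le n$ such that $x_i\notin D$ and $x_{i+2r+1}\notin D$ (i.e., no $2r+2$ consecutive vertices have both first and last vertex outside $D$); (2) there are no $2r+1$ consecutive vertices none of which is in $D$; (3) $\{x_{r+2},x_{r+3},\dots,x_{2r+1}\}\subseteq D$ and $\{x_{n-r-1},x_{n-r-2},\dots,x_{n-2r}\}\subseteq D$; (4) $\{x_1,x_2,\dots,x_{r+1}\}\cap D\neq\emptyset$ and $\{x_n,x_{n-1},\dots,x_{n-r}\}\cap D\neq\emptyset$.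
   Context: For a graph $G=(V,E)$ and integer $r\ge1$, $d(x,y)$ is the number of edges in a shortest path between $x$ and $y$, $N_r[x]=\{y\in V: d(x,y)\le r\}$, and for $D\subseteq V$, $D_r(x)=N_r[x]\cap D$. A set $D\subseteq V$ is an $r$-identifying code of $G$ if $D_r(x)\neq\emptyset$ for every $x\in V$ and $D_r(x)\neq D_r(y)$ for all distinct $x,y\in V$. -}

module Defs where

open import Data.Nat using (ℕ; zero; suc; _+_; _*_; _∸_; _≤_)
open import Data.Fin using (Fin; toℕ)
open import Data.Fin.Subset using (Subset; _∈_; _∉_)
open import Data.Product using (Σ; ∃; _×_; ∃-syntax)
open import Data.Sum using (_⊎_)
open import Relation.Binary.PropositionalEquality using (_≡_; _≢_)
open import Relation.Nullary using (¬_)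
open import Function.Bundles using (_⇔_)

record Graph (n : ℕ) : Set₁ where
  field
    Adj : Fin n → Fin n → Set

open Graph public

data Walk {n : ℕ} (G : Graph n) : ℕ → Fin n → Fin n → Set where
  here : ∀ {x} → Walk G zero x x
  step : ∀ {k x y z} → Adj G x y → Walk G k y z → Walk G (suc k) x z

-- d(x,y) ≤ r, i.e. y ∈ N_r[x]: there is a path (equivalently a walk) with at most r edges.
DistLe : ∀ {n} → Graph n → ℕ → Fin n → Fin n → Set
DistLe G r x y = ∃[ k ] (k ≤ r × Walk G k x y)

InDr : ∀ {n} → Graph n → ℕ → Subset n → Fin n → Fin n → Set
InDr G r D x z = z ∈ D × DistLe G r x z

IsIdentifyingCode : ∀ {n} → Graph n → ℕ → Subset n → Set
IsIdentifyingCode {n} G r D =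
  (∀ x → ∃[ z ] InDr G r D x z)
  × (∀ x y → x ≢ y → ¬ (∀ z → InDr G r D x z ⇔ InDr G r D y z))

-- 1-based label: vertex v : Fin n is x_(label v)
label : ∀ {n} → Fin n → ℕ
label v = suc (toℕ v)

Path : (n : ℕ) → Graph n
Path n = record { Adj = λ u v → label v ≡ suc (label u) ⊎ label u ≡ suc (label v) }

Cond1 : ∀ {n} → ℕ → Subset n → Set
Cond1 {n} r D = ¬ (∃[ u ] ∃[ v ] (label v ≡ label u + (2 * r + 1) × u ∉ D × v ∉ D))

Cond2 : ∀ {n} → ℕ → Subset n → Set
Cond2 {n} r D = ¬ (∃[ i ] (1 ≤ i × i + 2 * r ≤ n
                   × (∀ (v : Fin n) → i ≤ label v → label v ≤ i + 2 * r → v ∉ D)))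

Cond3 : ∀ {n} → ℕ → Subset n → Set
Cond3 {n} r D =
  (∀ (v : Fin n) → r + 2 ≤ label v → label v ≤ 2 * r + 1 → v ∈ D)
  × (∀ (v : Fin n) → n ∸ 2 * r ≤ label v → label v ≤ n ∸ (r + 1) → v ∈ D)

Cond4 : ∀ {n} → ℕ → Subset n → Set
Cond4 {n} r D =
  (∃[ v ] (label v ≤ r + 1 × v ∈ D))
  × (∃[ v ] (n ∸ r ≤ label v × v ∈ D))

module Submission where

-- Number the vertices of P_n by their indices 0 … n-1.  Then d(x,y) ≤ r holds
-- exactly when the indices a, b satisfy  a ≤ b + r  and  b ≤ a + r  (the relation
-- 'Near r a b'), so the ball N_r[x] is the index window [a-r, a+r] cut to [0, n-1].
-- Consequently D is an r-identifying code iff it is 'dominating' (every window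
-- meets D) and 'separating' (no two indices a < b are 'twins', i.e. have windows
-- containing the same codewords).  Both halves are then analysed through windows:
--   * the windows of a and a+1 differ only in the indices a-r and a+r+1, so when
--     neither is a codeword a and a+1 are twins; this yields conditions (1) and (3),
--     while domination at the ends and at a window centre yields (4) and (2);
--   * conversely, for a < b a separating codeword is found in one of four cases:
--     disjoint windows (domination), a near the left end (condition (3), first part),
--     b near the right end (condition (3), second part), or the interior, where the
--     two indices a-r and a+r+1 cannot both be non-codewords (condition (1)).

open import Data.Nat
open import Data.Nat.Properties
open import Data.Nat.Tactic.RingSolver using (solve)
open import Data.Fin using (Fin; toℕ; fromℕ<)
open import Data.Fin.Properties using (toℕ-fromℕ<; toℕ-injective; toℕ<n; any?)
open import Data.Fin.Subset using (Subset; _∈_; _∉_)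
open import Data.Fin.Subset.Properties using (_∈?_)
open import Data.List using (_∷_; [])
open import Data.Product using (_×_; _,_; proj₂; ∃-syntax; swap; map₂)
open import Data.Sum using (_⊎_; inj₁; inj₂)
import Data.Sum as Sum
open import Data.Empty using (⊥; ⊥-elim)
open import Relation.Nullary using (¬_; Dec; yes; no)
open import Relation.Nullary.Decidable using (_×-dec_; decidable-stable)
open import Relation.Binary.Definitions using (tri<; tri≈; tri>)
open import Relation.Binary.PropositionalEquality using (_≡_; _≢_; refl; sym; trans; cong; subst)
open import Function.Bundles using (_⇔_; mk⇔; Equivalence)
import Function.Properties.Equivalence as ⇔
open import Defs

-- Linear arithmetic over ℕ: if  A ≤ B  and  x + B + e = y + A  then  x ≤ y
-- (the difference y - x equals (B - A) + e).  Combined with the ring solver this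
-- discharges the routine linear inequalities below.
combine : ∀ {A B} x y e → A ≤ B → x + B + e ≡ y + A → x ≤ y
combine {A} {B} x y e A≤B eq = +-cancelʳ-≤ A x y
  (≤-trans (+-monoʳ-≤ x A≤B) (≤-trans (m≤m+n (x + B) e) (≤-reflexive eq)))

refute : ∀ {A B} e → A ≤ B → 1 + B + e ≡ A → ⊥
refute e A≤B eq with combine 1 0 e A≤B eq
... | ()

infixl 6 _⊕_
_⊕_ : ∀ {a b c d} → a ≤ b → c ≤ d → a + c ≤ b + d
_⊕_ = +-mono-≤

Near : ℕ → ℕ → ℕ → Set
Near r a b = a ≤ b + r × b ≤ a + r

near? : ∀ r a b → Dec (Near r a b)
near? r a b = (a ≤? b + r) ×-dec (b ≤? a + r)

near-refl : ∀ {r a} → Near r a a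
near-refl {r} {a} = m≤m+n a r , m≤m+n a r

near-sym : ∀ {r a b} → Near r a b → Near r b a
near-sym = swap

near-mono : ∀ {j k a b} → j ≤ k → Near j a b → Near k a b
near-mono {a = a} {b} j≤k (ab , ba) = ≤-trans ab (+-monoʳ-≤ b j≤k) , ≤-trans ba (+-monoʳ-≤ a j≤k)

near-trans : ∀ {j k a b c} → Near j a b → Near k b c → Near (j + k) a c
near-trans {j} {k} {a} {b} {c} (ab , ba) (bc , cb) =
  combine a (c + (j + k)) 0 (ab ⊕ bc) (solve (j ∷ k ∷ a ∷ b ∷ c ∷ [])) ,
  combine c (a + (j + k)) 0 (cb ⊕ ba) (solve (j ∷ k ∷ a ∷ b ∷ c ∷ []))

near-offset : ∀ {r a d} → d ≤ r → Near r a (a + d)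
near-offset {r} {a} {d} d≤r = ≤-trans (m≤m+n a d) (m≤m+n (a + d) r) , +-monoʳ-≤ a d≤r

near-apart : ∀ {r a b c} → Near r a c → Near r b c → b ≤ a + 2 * r
near-apart {r} {a} {b} ac bc =
  combine b (a + 2 * r) 0 (proj₂ (near-trans ac (near-sym bc))) (solve (r ∷ a ∷ b ∷ []))

near-succ-left : ∀ {r a c} → Near r a c → Near r (suc a) c ⊎ c + r ≡ a
near-succ-left (ac , ca) with m≤n⇒m<n∨m≡n ac
... | inj₁ a<c+r = inj₁ (a<c+r , m≤n⇒m≤1+n ca)
... | inj₂ a≡c+r = inj₂ (sym a≡c+r)

near-succ-right : ∀ {r a c} → Near r (suc a) c → Near r a c ⊎ c ≡ suc (a + r)
near-succ-right (ac , ca) with m≤n⇒m<n∨m≡n ca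
... | inj₁ c<a+r+1 = inj₁ (<⇒≤ ac , s≤s⁻¹ c<a+r+1)
... | inj₂ c≡a+r+1 = inj₂ c≡a+r+1

near-window : ∀ {r j c} → Near r (r + j) c → j ≤ c × c ≤ j + 2 * r
near-window {r} {j} {c} (lo , hi) =
  combine j c 0 lo (solve (r ∷ j ∷ c ∷ [])) , combine c (j + 2 * r) 0 hi (solve (r ∷ j ∷ c ∷ []))

window-near : ∀ {r j c} → j ≤ c → c ≤ j + 2 * r → Near r (r + j) c
window-near {r} {j} {c} lo hi =
  combine (r + j) (c + r) 0 lo (solve (r ∷ j ∷ c ∷ [])) ,
  combine c (r + j + r) 0 hi (solve (r ∷ j ∷ c ∷ []))

module _ {n : ℕ} {G : Graph n} (adj-sym : ∀ {x y} → Adj G x y → Adj G y x) where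

  walk-snoc : ∀ {k x y z} → Walk G k x y → Adj G y z → Walk G (suc k) x z
  walk-snoc here         yz = step yz here
  walk-snoc (step xw wy) yz = step xw (walk-snoc wy yz)

  walk-reverse : ∀ {k x y} → Walk G k x y → Walk G k y x
  walk-reverse here         = here
  walk-reverse (step xw wy) = walk-snoc (walk-reverse wy) (adj-sym xw)

module _ {n : ℕ} where

  successor-near : ∀ {x y : Fin n} → toℕ y ≡ suc (toℕ x) → Near 1 (toℕ x) (toℕ y)
  successor-near {x} y≡x+1 = subst (Near 1 (toℕ x)) (trans (+-comm (toℕ x) 1) (sym y≡x+1)) (near-offset ≤-refl)

  adjacent⇒near : ∀ {x y : Fin n} → Adj (Path n) x y → Near 1 (toℕ x) (toℕ y)
  adjacent⇒near (inj₁ e) = successor-near (suc-injective e)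
  adjacent⇒near (inj₂ e) = near-sym (successor-near (suc-injective e))

  walk⇒near : ∀ {k} {x y : Fin n} → Walk (Path n) k x y → Near k (toℕ x) (toℕ y)
  walk⇒near here       = near-refl
  walk⇒near (step e w) = near-trans (adjacent⇒near e) (walk⇒near w)

  walk-up : ∀ d (x y : Fin n) → toℕ y ≡ toℕ x + d → Walk (Path n) d x y
  walk-up zero x y y≡x =
    subst (Walk (Path n) 0 x) (toℕ-injective (trans (sym (+-identityʳ (toℕ x))) (sym y≡x))) here
  walk-up (suc d) x y y≡x+d+1 = step (inj₁ (cong suc next-index)) (walk-up d next y y≡next+d)
    where
      next-bound : suc (toℕ x) < n
      next-bound = ≤-<-trans (≤-trans (s≤s (m≤m+n (toℕ x) d))
                     (≤-reflexive (trans (sym (+-suc (toℕ x) d)) (sym y≡x+d+1)))) (toℕ<n y)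
      next : Fin n
      next = fromℕ< next-bound
      next-index : toℕ next ≡ suc (toℕ x)
      next-index = toℕ-fromℕ< next-bound
      y≡next+d : toℕ y ≡ toℕ next + d
      y≡next+d = trans y≡x+d+1 (trans (+-suc (toℕ x) d) (cong (_+ d) (sym next-index)))

  upward-distLe : ∀ r (x y : Fin n) → toℕ x ≤ toℕ y → toℕ y ≤ toℕ x + r → DistLe (Path n) r x y
  upward-distLe r x y x≤y y≤x+r =
    let (d , x+d≡y) = m≤n⇒∃[o]m+o≡n x≤y in
    d , +-cancelˡ-≤ (toℕ x) d r (subst (_≤ toℕ x + r) (sym x+d≡y) y≤x+r) , walk-up d x y (sym x+d≡y)

  distLe⇔near : ∀ r (x y : Fin n) → DistLe (Path n) r x y ⇔ Near r (toℕ x) (toℕ y)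
  distLe⇔near r x y = mk⇔ (λ (k , k≤r , w) → near-mono k≤r (walk⇒near w)) near⇒distLe
    where
      near⇒distLe : Near r (toℕ x) (toℕ y) → DistLe (Path n) r x y
      near⇒distLe (xy , yx) with ≤-total (toℕ x) (toℕ y)
      ... | inj₁ x≤y = upward-distLe r x y x≤y yx
      ... | inj₂ y≤x =
        let (k , k≤r , w) = upward-distLe r y x y≤x xy in k , k≤r , walk-reverse Sum.swap w

module PathCodes (r n : ℕ) (D : Subset n) where
  open Equivalence

  Dominated : ℕ → Set
  Dominated a = ∃[ z ] (z ∈ D × Near r a (toℕ z))

  Twins : ℕ → ℕ → Set
  Twins a b = ∀ z → z ∈ D → Near r a (toℕ z) ⇔ Near r b (toℕ z)

  Dominating : Set
  Dominating = ∀ a → a < n → Dominated a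

  Separating : Set
  Separating = ∀ a b → a < b → b < n → ¬ Twins a b

  vertex-with : ∀ {c} (P : ℕ → Set) → c < n → P c → ∃[ w ] P (toℕ w)
  vertex-with P c<n pc = fromℕ< c<n , subst P (sym (toℕ-fromℕ< c<n)) pc

  vertex : ∀ {a} → a < n → ∃[ x ] toℕ x ≡ a
  vertex a<n = vertex-with (_≡ _) a<n refl

  ∈-at : ∀ {z v : Fin n} → toℕ z ≡ toℕ v → z ∈ D → v ∈ D
  ∈-at z≡v = subst (_∈ D) (toℕ-injective z≡v)

  twins-sym : ∀ {a b} → Twins a b → Twins b a
  twins-sym tw z z∈D = ⇔.sym (tw z z∈D)

  twin-outside : ∀ {a b} {z : Fin n} → Twins a b → Near r a (toℕ z) → ¬ Near r b (toℕ z) → z ∉ D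
  twin-outside tw a~z b≁z z∈D = b≁z (to (tw _ z∈D) a~z)

  inDr⇔ : ∀ x z → InDr (Path n) r D x z ⇔ (z ∈ D × Near r (toℕ x) (toℕ z))
  inDr⇔ x z = mk⇔ (map₂ (to (distLe⇔near r x z))) (map₂ (from (distLe⇔near r x z)))

  transfer-near : ∀ {x y z} → z ∈ D → (InDr (Path n) r D x z → InDr (Path n) r D y z)
                → Near r (toℕ x) (toℕ z) → Near r (toℕ y) (toℕ z)
  transfer-near {x} {y} {z} z∈D f x~z = proj₂ (to (inDr⇔ y z) (f (from (inDr⇔ x z) (z∈D , x~z))))

  transfer-inDr : ∀ {x y z} → (z ∈ D → Near r (toℕ x) (toℕ z) → Near r (toℕ y) (toℕ z))
                → InDr (Path n) r D x z → InDr (Path n) r D y z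
  transfer-inDr {x} {y} {z} f i =
    let (z∈D , x~z) = to (inDr⇔ x z) i in from (inDr⇔ y z) (z∈D , f z∈D x~z)

  identifying⇔ : IsIdentifyingCode (Path n) r D ⇔ (Dominating × Separating)
  identifying⇔ = mk⇔ (λ (dom , sep) → dominating dom , separating sep) (λ (dom , sep) → dom′ dom , sep′ sep)
    where
      dominating : (∀ x → ∃[ z ] InDr (Path n) r D x z) → Dominating
      dominating dom a a<n with vertex a<n
      ... | x , refl = let (z , i) = dom x in z , to (inDr⇔ x z) i

      separating : (∀ x y → x ≢ y → ¬ (∀ z → InDr (Path n) r D x z ⇔ InDr (Path n) r D y z)) → Separating
      separating sep a b a<b b<n tw with vertex (<-trans a<b b<n) | vertex b<n
      ... | x , refl | y , refl =
        sep x y (λ x≡y → <-irrefl (cong toℕ x≡y) a<b)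
          (λ z → mk⇔ (transfer-inDr (λ z∈D → to (tw z z∈D))) (transfer-inDr (λ z∈D → from (tw z z∈D))))

      dom′ : Dominating → ∀ x → ∃[ z ] InDr (Path n) r D x z
      dom′ dom x = let (z , z∈D , x~z) = dom (toℕ x) (toℕ<n x) in z , from (inDr⇔ x z) (z∈D , x~z)

      sep′ : Separating → ∀ x y → x ≢ y → ¬ (∀ z → InDr (Path n) r D x z ⇔ InDr (Path n) r D y z)
      sep′ sep x y x≢y same with <-cmp (toℕ x) (toℕ y)
      ... | tri< x<y _ _ = sep _ _ x<y (toℕ<n y) twins
        where
          twins : Twins (toℕ x) (toℕ y)
          twins z z∈D = mk⇔ (transfer-near z∈D (to (same z))) (transfer-near z∈D (from (same z)))
      ... | tri≈ _ x≡y _ = x≢y (toℕ-injective x≡y)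
      ... | tri> _ _ y<x = sep _ _ y<x (toℕ<n x) twins
        where
          twins : Twins (toℕ y) (toℕ x)
          twins z z∈D = mk⇔ (transfer-near z∈D (from (same z))) (transfer-near z∈D (to (same z)))

  consecutive-twins : ∀ a → (∀ z → z ∈ D → toℕ z + r ≢ a) → (∀ z → z ∈ D → toℕ z ≢ suc (a + r))
                    → Twins a (suc a)
  consecutive-twins a no-left no-right z z∈D = mk⇔ forward backward
    where
      forward : Near r a (toℕ z) → Near r (suc a) (toℕ z)
      forward a~z with near-succ-left a~z
      ... | inj₁ a+1~z = a+1~z
      ... | inj₂ z+r≡a = ⊥-elim (no-left z z∈D z+r≡a)

      backward : Near r (suc a) (toℕ z) → Near r a (toℕ z)
      backward a+1~z with near-succ-right a+1~z
      ... | inj₁ a~z     = a~z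
      ... | inj₂ z≡a+r+1 = ⊥-elim (no-right z z∈D z≡a+r+1)

  -- Condition (1): u and v are the boundary indices of the consecutive pair u+r, u+r+1.
  cond1-necessary : Separating → Cond1 r D
  cond1-necessary sep (u , v , v≡u+2r+1 , u∉D , v∉D) with toℕ u in u-index
  ... | i = sep (i + r) (suc (i + r)) (n<1+n (i + r)) bound (consecutive-twins (i + r) not-left not-right)
    where
      v-index : toℕ v ≡ suc (i + r + r)
      v-index = trans (suc-injective v≡u+2r+1) (solve (i ∷ r ∷ []))
      bound : suc (i + r) < n
      bound = ≤-trans (s≤s (s≤s (m≤m+n (i + r) r))) (≤-trans (≤-reflexive (cong suc (sym v-index))) (toℕ<n v))
      not-left : ∀ z → z ∈ D → toℕ z + r ≢ i + r
      not-left z z∈D z+r≡i+r = u∉D (∈-at (trans (+-cancelʳ-≡ r (toℕ z) i z+r≡i+r) (sym u-index)) z∈D)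
      not-right : ∀ z → z ∈ D → toℕ z ≢ suc (i + r + r)
      not-right z z∈D z≡i+2r+1 = v∉D (∈-at (trans z≡i+2r+1 (sym v-index)) z∈D)

  -- Condition (2): the window around r + j is the block [j, j + 2r].
  cond2-necessary : Dominating → Cond2 r D
  cond2-necessary dom (suc j , _ , block-fits , block-empty) =
    let (z , z∈D , centre~z) = dom (r + j) centre<n
        (lo , hi) = near-window centre~z
    in block-empty z (s≤s lo) (s≤s hi) z∈D
    where
      centre<n : r + j < n
      centre<n = combine (suc (r + j)) n r block-fits (solve (r ∷ j ∷ n ∷ []))

  -- Condition (3), left part: were x_{r+k+2} (k < r) no codeword, indices k, k+1 would be twins.
  cond3-left-necessary : 2 * r + 1 ≤ n → Separating
                       → ∀ (v : Fin n) → r + 2 ≤ label v → label v ≤ 2 * r + 1 → v ∈ D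
  cond3-left-necessary hn sep v lo hi with toℕ v in v-index
  ... | b with m≤n⇒∃[o]m+o≡n (combine (suc r) b 0 lo (solve (r ∷ b ∷ [])))
  ...   | k , refl = decidable-stable (v ∈? D) λ v∉D →
    sep k (suc k) (n<1+n k) bound (consecutive-twins k not-left (not-right v∉D))
    where
      k<r : k < r
      k<r = combine (suc k) r 0 hi (solve (k ∷ r ∷ []))
      bound : suc k < n
      bound = combine (suc (suc k)) n r (k<r ⊕ hn) (solve (k ∷ r ∷ n ∷ []))
      not-left : ∀ z → z ∈ D → toℕ z + r ≢ k
      not-left z _ z+r≡k = <⇒≱ k<r (≤-trans (m≤n+m r (toℕ z)) (≤-reflexive z+r≡k))
      not-right : v ∉ D → ∀ z → z ∈ D → toℕ z ≢ suc (k + r)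
      not-right v∉D z z∈D z≡k+r+1 =
        v∉D (∈-at (trans z≡k+r+1 (trans (cong suc (+-comm k r)) (sym v-index))) z∈D)

  -- Condition (3), right part: were x_{b+1} no codeword, indices b+r, b+r+1 would be twins.
  cond3-right-necessary : 2 * r + 1 ≤ n → Separating
                        → ∀ (v : Fin n) → n ∸ 2 * r ≤ label v → label v ≤ n ∸ (r + 1) → v ∈ D
  cond3-right-necessary hn sep v lo hi with toℕ v in v-index
  ... | b = decidable-stable (v ∈? D) λ v∉D →
    sep (b + r) (suc (b + r)) (n<1+n (b + r)) bound (consecutive-twins (b + r) (not-left v∉D) not-right)
    where
      n≤ : n ≤ 2 * r + suc b
      n≤ = ≤-trans (m≤n+m∸n n (2 * r)) (+-monoʳ-≤ (2 * r) lo)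
      fits : suc b + (r + 1) ≤ n
      fits = m≤o∸n⇒m+n≤o (suc b) (combine (r + 1) n r hn (solve (r ∷ n ∷ []))) hi
      bound : suc (b + r) < n
      bound = combine (suc (suc (b + r))) n 0 fits (solve (b ∷ r ∷ n ∷ []))
      not-left : v ∉ D → ∀ z → z ∈ D → toℕ z + r ≢ b + r
      not-left v∉D z z∈D z+r≡b+r = v∉D (∈-at (trans (+-cancelʳ-≡ r (toℕ z) b z+r≡b+r) (sym v-index)) z∈D)
      beyond-end : suc (suc (b + r + r)) ≤ n → ⊥
      beyond-end out = refute 0 (out ⊕ n≤) (solve (b ∷ r ∷ n ∷ []))
      not-right : ∀ z → z ∈ D → toℕ z ≢ suc (b + r + r)
      not-right z _ z≡b+2r+1 = beyond-end (subst (λ t → suc t ≤ n) z≡b+2r+1 (toℕ<n z))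

  cond3-necessary : 2 * r + 1 ≤ n → Separating → Cond3 r D
  cond3-necessary hn sep = cond3-left-necessary hn sep , cond3-right-necessary hn sep

  -- Condition (4): domination of the two end vertices.
  cond4-necessary : 2 * r + 1 ≤ n → Dominating → Cond4 r D
  cond4-necessary hn dom = left-end , right-end
    where
      0<n : 0 < n
      0<n = ≤-trans (m≤n+m 1 (2 * r)) hn
      left-end : ∃[ v ] (label v ≤ r + 1 × v ∈ D)
      left-end = let (z , z∈D , (_ , z≤r)) = dom 0 0<n in
        z , ≤-trans (s≤s z≤r) (≤-reflexive (+-comm 1 r)) , z∈D
      right-end : ∃[ v ] (n ∸ r ≤ label v × v ∈ D)
      right-end =
        let (m , 1+m≡n) = m≤n⇒∃[o]m+o≡n 0<n
            (z , z∈D , (m≤z+r , _)) = dom m (≤-reflexive 1+m≡n)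
            n≤ = ≤-trans (≤-reflexive (sym 1+m≡n)) (≤-trans (s≤s m≤z+r) (≤-reflexive (+-comm (suc (toℕ z)) r)))
        in z , m≤n+o⇒m∸n≤o n r n≤ , z∈D

  dominated-right-end : Cond4 r D → ∀ a → a < n → n ≤ a + r → Dominated a
  dominated-right-end (_ , (v , lo , v∈D)) a a<n n≤a+r = v , v∈D , a≤v+r , <⇒≤ (≤-trans (toℕ<n v) n≤a+r)
    where
      n≤ : n ≤ r + suc (toℕ v)
      n≤ = ≤-trans (m≤n+m∸n n r) (+-monoʳ-≤ r lo)
      a≤v+r : a ≤ toℕ v + r
      a≤v+r = ≤-trans (s≤s⁻¹ (≤-trans a<n (≤-trans n≤ (≤-reflexive (+-suc r (toℕ v))))))
                      (≤-reflexive (+-comm r (toℕ v)))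

  dominated-left-end : Cond4 r D → ∀ a → a < r → Dominated a
  dominated-left-end ((v , hi , v∈D) , _) a a<r =
    v , v∈D , ≤-trans (<⇒≤ a<r) (m≤n+m r (toℕ v)) , ≤-trans v≤r (m≤n+m r a)
    where
      v≤r : toℕ v ≤ r
      v≤r = s≤s⁻¹ (≤-trans hi (≤-reflexive (+-comm r 1)))

  -- In the interior the window of r + j is a full block [j, j + 2r], which condition (2)
  -- forbids to be free of codewords.
  dominated-interior : Cond2 r D → ∀ j → r + j + r < n → Dominated (r + j)
  dominated-interior c2 j bound with any? (λ z → (z ∈? D) ×-dec near? r (r + j) (toℕ z))
  ... | yes found = found
  ... | no none = ⊥-elim (c2 (suc j , s≤s z≤n , block-fits , block-empty))
    where
      block-fits : suc j + 2 * r ≤ n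
      block-fits = combine (suc j + 2 * r) n 0 bound (solve (j ∷ r ∷ n ∷ []))
      block-empty : ∀ v → suc j ≤ label v → label v ≤ suc j + 2 * r → v ∉ D
      block-empty v lo hi v∈D = none (v , v∈D , window-near (s≤s⁻¹ lo) (s≤s⁻¹ hi))

  dominating : Cond2 r D → Cond4 r D → Dominating
  dominating c2 c4 a a<n with n ≤? a + r | r ≤? a
  ... | yes n≤a+r | _     = dominated-right-end c4 a a<n n≤a+r
  ... | no _      | no r≰a = dominated-left-end c4 a (≰⇒> r≰a)
  ... | no a+r≮n  | yes r≤a with m≤n⇒∃[o]m+o≡n r≤a
  ...   | j , refl = dominated-interior c2 j (≰⇒> a+r≮n)

  -- Separation of a < b, in four cases.  Windows more than 2r apart are disjoint.
  twins-far-apart : ∀ {a b} → Dominated a → a + 2 * r < b → ¬ Twins a b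
  twins-far-apart (z , z∈D , a~z) far tw = <⇒≱ far (near-apart a~z (to (tw z z∈D) a~z))

  -- For a < r the codeword a+r+1 of condition (3), left part, lies in the window of b only.
  twins-left-end : 2 * r + 1 ≤ n → Cond3 r D → ∀ {a b} → a < r → a < b → b ≤ a + 2 * r → ¬ Twins a b
  twins-left-end hn (c3-left , _) {a} {b} a<r a<b close tw =
    let (w , (lo , hi) , b~w , a≁w) = vertex-with Facts w<n facts
    in twin-outside (twins-sym tw) b~w a≁w (c3-left w lo hi)
    where
      Facts : ℕ → Set
      Facts c = (r + 2 ≤ suc c × suc c ≤ 2 * r + 1) × Near r b c × ¬ Near r a c
      w<n : suc (a + r) < n
      w<n = combine (suc (suc (a + r))) n 0 (a<r ⊕ hn) (solve (a ∷ r ∷ n ∷ []))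
      facts : Facts (suc (a + r))
      facts = ( ≤-trans (≤-reflexive (+-comm r 2)) (s≤s (s≤s (m≤n+m r a)))
              , combine (suc (suc (a + r))) (2 * r + 1) 0 a<r (solve (a ∷ r ∷ [])) )
            , ( combine b (suc (a + r) + r) 1 close (solve (a ∷ b ∷ r ∷ [])) , +-monoˡ-≤ r a<b )
            , λ (_ , beyond) → n≮n (a + r) beyond

  -- For b + r ≥ n the codeword b-r-1 of condition (3), right part, lies in the window of a only.
  twins-right-end : Cond3 r D → ∀ {a b} → r ≤ a → a < b → b ≤ a + 2 * r → n ≤ b + r → b < n → ¬ Twins a b
  twins-right-end (_ , c3-right) {a} {b} r≤a a<b close n≤b+r b<n tw
    with m≤n⇒∃[o]m+o≡n (≤-<-trans r≤a a<b)
  ... | e , refl =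
    let (w , (lo , hi) , a~w , b≁w) = vertex-with Facts e<n facts
    in twin-outside tw a~w b≁w (c3-right w lo hi)
    where
      Facts : ℕ → Set
      Facts c = (n ∸ 2 * r ≤ suc c × suc c ≤ n ∸ (r + 1)) × Near r a c × ¬ Near r (suc r + e) c
      e<n : e < n
      e<n = <-trans (s≤s (m≤n+m e r)) b<n
      facts : Facts e
      facts = ( m≤n+o⇒m∸n≤o n (2 * r) (combine n (2 * r + suc e) 0 n≤b+r (solve (e ∷ r ∷ n ∷ [])))
              , m+n≤o⇒m≤o∸n (suc e) (combine (suc e + (r + 1)) n 0 b<n (solve (e ∷ r ∷ n ∷ []))) )
            , ( ≤-trans (s≤s⁻¹ a<b) (≤-reflexive (+-comm r e))
              , combine e (a + r) 1 close (solve (a ∷ e ∷ r ∷ [])) )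
            , λ (beyond , _) → <-irrefl (+-comm r e) beyond

  -- In the interior, a-r lies in the window of a only and a+r+1 in that of b only;
  -- condition (1) forbids both to be non-codewords.
  twins-interior : Cond1 r D → ∀ {a b} → r ≤ a → a < b → b ≤ a + 2 * r → b + r < n → ¬ Twins a b
  twins-interior c1 {a} {b} r≤a a<b close b+r<n tw with m≤n⇒∃[o]m+o≡n r≤a
  ... | j , refl =
    let (u , (u≡j , a~u , b≁u)) = vertex-with (λ c → c ≡ j × Near r (r + j) c × ¬ Near r b c) u<n u-facts
        (v , (v≡j+2r+1 , b~v , a≁v)) = vertex-with (λ c → c ≡ j + (2 * r + 1) × Near r b c × ¬ Near r (r + j) c)
                                                   v<n v-facts
    in c1 ( u , v , cong suc (trans v≡j+2r+1 (cong (_+ (2 * r + 1)) (sym u≡j)))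
          , twin-outside tw a~u b≁u , twin-outside (twins-sym tw) b~v a≁v )
    where
      v<n : j + (2 * r + 1) < n
      v<n = combine (suc (j + (2 * r + 1))) n 0 (a<b ⊕ b+r<n) (solve (j ∷ b ∷ r ∷ n ∷ []))
      u<n : j < n
      u<n = ≤-<-trans (m≤m+n j (2 * r + 1)) v<n
      u-facts : j ≡ j × Near r (r + j) j × ¬ Near r b j
      u-facts = refl , window-near ≤-refl (m≤m+n j (2 * r))
                     , λ (b≤j+r , _) → <-irrefl (+-comm r j) (≤-trans a<b b≤j+r)
      v-facts : j + (2 * r + 1) ≡ j + (2 * r + 1) × Near r b (j + (2 * r + 1)) × ¬ Near r (r + j) (j + (2 * r + 1))
      v-facts = refl
              , ( combine b (j + (2 * r + 1) + r) 1 close (solve (j ∷ b ∷ r ∷ []))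
                , combine (j + (2 * r + 1)) (b + r) 0 a<b (solve (j ∷ b ∷ r ∷ [])) )
              , λ (_ , beyond) → refute 0 beyond (solve (j ∷ r ∷ []))

  separating : 2 * r + 1 ≤ n → Cond1 r D → Cond3 r D → Dominating → Separating
  separating hn c1 c3 dom a b a<b b<n with a + 2 * r <? b | r ≤? a | n ≤? b + r
  ... | yes far | _       | _          = twins-far-apart (dom a (<-trans a<b b<n)) far
  ... | no near | no r≰a  | _          = twins-left-end hn c3 (≰⇒> r≰a) a<b (≮⇒≥ near)
  ... | no near | yes r≤a | yes n≤b+r  = twins-right-end c3 r≤a a<b (≮⇒≥ near) n≤b+r b<n
  ... | no near | yes r≤a | no b+r≮n   = twins-interior c1 r≤a a<b (≮⇒≥ near) (≰⇒> b+r≮n)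

lemma10 : (r n : ℕ) → 1 ≤ r → 2 * r + 1 ≤ n → (D : Subset n) →
    IsIdentifyingCode (Path n) r D ⇔ (Cond1 r D × Cond2 r D × Cond3 r D × Cond4 r D)
lemma10 r n _ hn D = mk⇔ necessary sufficient
  where
    open PathCodes r n D
    open Equivalence identifying⇔

    necessary : IsIdentifyingCode (Path n) r D → Cond1 r D × Cond2 r D × Cond3 r D × Cond4 r D
    necessary code =
      let (dom , sep) = to code
      in cond1-necessary sep , cond2-necessary dom , cond3-necessary hn sep , cond4-necessary hn dom

    sufficient : Cond1 r D × Cond2 r D × Cond3 r D × Cond4 r D → IsIdentifyingCode (Path n) r D
    sufficient (c1 , c2 , c3 , c4) =
      let dom = dominating c2 c4
      in from (dom , separating hn c1 c3 dom)
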